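{- Let $n\ge 3$. For every $r\in\mathbb R^+$ and every $h\in\{0,1,\ldots,n\}$, there are infinitely many instances $\boldsymbol k=(k_0,\ldots,k_n)$ such that $P(\{\mathcal E_{n,h}\},\boldsymbol k) > r$.
   Context: A matrix chain of length $n$ is a product $M_1 M_2 \cdots M_n$ where $M_i$ has size $k_{i-1}\times k_i$; an instance is a tuple $\boldsymbol k=(k_0,k_1,\ldots,k_n)$ of positive integers. $\mathcal S_n$ denotes the set of all (full) parenthesisations (called orderings) of $M_1\cdots M_n$. Each of the $n-1$ multiplications in an ordering multiplies $(M_{a+1}\cdots M_b)$ by $(M_{b+1}\cdots M_c)$ for some $0\le a<b<c\le n$ at cost $k_a k_b k_c$; the cost $T(\mathcal A,\boldsymbol k)$ of an ordering is the sum of the costs of its $n-1$ multiplications. For a proper subset $\mathcal Q\subsetneq \mathcal S_n$, the penalty of removing $\mathcal Q$ on instance $\boldsymbol k$ is $$P(\mathcal Q,\boldsymbol k)=\frac{\min_{\mathcal B\in\mathcal S_n\setminus\mathcal Q}T(\mathcal B,\boldsymbol k)}{\min_{\mathcal A\in\mathcal S_n}T(\mathcal A,\boldsymbol k)}-1.$$ For $h\in\{0,1,\ldots,n\}$, $\mathcal E_{n,h}$ is the ordering that "fans out" from dimension $k_h$: it is $L_h R_h$, where $L_h=(M_1(M_2(\cdots(M_{h-1}M_h)\cdots)))$ is the right-to-left product of $M_1,\ldots,M_h$, $R_h=((\cdots(M_{h+1}M_{h+2})\cdots M_{n-1})M_n)$ is the left-to-right product of $M_{h+1},\ldots,M_n$,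 and an empty product ($h=0$ or $h=n$) is omitted (so $\mathcal E_{n,0}$ is the fully left-to-right and $\mathcal E_{n,n}$ the fully right-to-left ordering). Equivalently, $\mathcal E_{n,h}$ is the ordering in which every multiplication's cost term contains $k_h$.
   Formalization: The threshold r ranges over the positive rationals rather than over all of $\mathbb R^+$. -}

module Defs where

open import Data.Nat using (ℕ; zero; suc; _+_; _*_; _∸_; _⊓_)
open import Data.Bool using (Bool; true; false; not; _∧_; _∨_)
open import Data.List as List using (List; []; _∷_; concat; filterᵇ; map; cartesianProductWith)
open import Data.Vec as Vec using (Vec; []; _∷_; _∷ʳ_; zipWith; reverse; toList)
open import Data.Integer using (+_)
open import Data.Rational using (ℚ; _/_; _-_; 1ℚ; 0ℚ)
open import Relation.Nullary using (does)
open import Relation.Unary using (Pred)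

-- Orderings (full parenthesisations) as binary trees; the leaves, read
-- left to right, are the consecutive matrices of the (sub)chain.
data Tree : Set where
  leaf : Tree
  node : Tree → Tree → Tree

size : Tree → ℕ
size leaf       = 1
size (node l r) = size l + size r

_==_ : Tree → Tree → Bool
leaf       == leaf         = true
leaf       == node _ _     = false
node _ _   == leaf         = false
node l r   == node l′ r′   = (l == l′) ∧ (r == r′)

_∈ᵇ_ : Tree → List Tree → Bool
t ∈ᵇ []       = false
t ∈ᵇ (u ∷ us) = (t == u) ∨ (t ∈ᵇ us)

-- Index into an instance k = (k_0,…,k_n) (out of range indices give 0;
-- never used for well-sized trees).
_!_ : ∀ {m} → Vec ℕ m → ℕ → ℕ
[]       ! _     = 0
(x ∷ xs) ! zero  = x
(x ∷ xs) ! suc i = xs ! i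

-- cost k a t : cost of the ordering t of the subchain M_{a+1} ⋯ M_{a + size t};
-- a multiplication of (M_{a+1}⋯M_b) by (M_{b+1}⋯M_c) costs k_a k_b k_c.
cost : ∀ {m} → Vec ℕ m → ℕ → Tree → ℕ
cost k a leaf       = 0
cost k a (node l r) =
  cost k a l + cost k (a + size l) r
  + k ! a * k ! (a + size l) * k ! (a + size l + size r)

T : ∀ {n} → Tree → Vec ℕ (suc n) → ℕ
T A k = cost k 0 A

-- Enumeration of all orderings.
-- table m = (orderings with 1 leaf, …, orderings with m leaves)
private
  next : ∀ {m} → Vec (List Tree) m → List Tree
  next []         = leaf ∷ []
  next v@(_ ∷ _)  = concat (toList (zipWith (cartesianProductWith node) v (reverse v)))

  table : (m : ℕ) → Vec (List Tree) m
  table zero    = []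
  table (suc m) = table m ∷ʳ next (table m)

𝒮 : ℕ → List Tree
𝒮 zero    = []
𝒮 (suc m) = Vec.last (table (suc m))

-- minimum of a list of naturals (0 for the empty list; never used on empty lists)
minList : List ℕ → ℕ
minList []           = 0
minList (x ∷ [])     = x
minList (x ∷ y ∷ ys) = x ⊓ minList (y ∷ ys)

minCost : (n : ℕ) → Vec ℕ (suc n) → ℕ
minCost n k = minList (map (λ A → T A k) (𝒮 n))

minCostWithout : (n : ℕ) → List Tree → Vec ℕ (suc n) → ℕ
minCostWithout n Q k =
  minList (map (λ B → T B k) (filterᵇ (λ B → not (B ∈ᵇ Q)) (𝒮 n)))

-- penalty P(𝒬, k) = min_{B ∉ 𝒬} T(B,k) / min_A T(A,k) − 1
-- (junk value 0 if the optimal cost is 0, which never happens for n ≥ 2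
--  and positive k)
P : (n : ℕ) → List Tree → Vec ℕ (suc n) → ℚ
P n Q k with minCost n k
... | zero  = 0ℚ
... | suc d = ((+ minCostWithout n Q k) / suc d) - 1ℚ

rightComb : ℕ → Tree
rightComb zero    = leaf
rightComb (suc m) = node leaf (rightComb m)

leftComb : ℕ → Tree
leftComb zero    = leaf
leftComb (suc m) = node (leftComb m) leaf

ℰ : ℕ → ℕ → Tree
ℰ n zero with n ∸ 1
... | m = leftComb m
ℰ n (suc h) with n ∸ suc h
... | zero  = rightComb h
... | suc m = node (rightComb h) (leftComb m)

-- Take the instance k with k_h = 1 and every other dimension N. Every multiplication of
-- ℰ_{n,h} has the factor k_h = 1, so T(ℰ_{n,h}, k) < n N². Conversely, ℰ_{n,h} is the only
-- ordering all of whose multiplications involve k_h, so every other ordering performs a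
-- multiplication of cost N³. Hence P({ℰ_{n,h}}, k) > N/n − 1, which exceeds r once N is large;
-- taking N larger than every entry of a given finite list of instances makes k a new one.

module Submission where

open import Defs
open import Data.Nat using (ℕ; zero; suc; _+_; _*_; _∸_; _≤_; _<_; _≟_; s≤s; z≤n; z<s)
open import Data.Nat.Properties
open import Data.Integer as ℤ using (-[1+_]; +<+; -<+)
import Data.Integer.Properties as ℤ
open import Data.Rational as ℚ using (ℚ; mkℚ; 0ℚ; 1ℚ; _/_; _-_; toℚᵘ)
open import Data.Rational.Properties using (toℚᵘ-cancel-<; toℚᵘ-homo-+; toℚᵘ-fromℚᵘ)
open import Data.Rational.Unnormalised as ℚᵘ using (mkℚᵘ; *<*)
open import Data.Rational.Unnormalised.Properties using (<-respʳ-≃; ≃-sym; ≃-trans; +-congˡ)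
open import Data.Bool as Bool using (Bool; true; not)
open import Data.Vec as Vec using (Vec; []; _∷_; _∷ʳ_; zipWith; reverse; toList)
import Data.Vec.Properties as Vecₚ
open import Data.Vec.Relation.Unary.All using (All; []; _∷_)
open import Data.List using (List; []; _∷_; [_]; concat; cartesianProductWith; map; filterᵇ)
open import Data.Nat.ListAction using (sum)
open import Data.List.Membership.Propositional using (_∈_; _∉_)
open import Data.List.Membership.Propositional.Properties
open import Data.List.Relation.Unary.Any using (here; there)
open import Data.Product using (Σ; ∃; _×_; _,_; proj₁; proj₂)
open import Data.Sum as Sum using (_⊎_; inj₁; inj₂)
open import Data.Unit using (⊤; tt)
open import Data.Empty using (⊥-elim)
open import Function using (_∘_)
open import Function.Bundles using (_⇔_; mk⇔; Equivalence)
open import Algebra.Properties.CommutativeSemigroup +-commutativeSemigroup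
  using () renaming (interchange to +-interchange)
open import Relation.Nullary using (yes; no; ¬_)
open import Relation.Nullary.Decidable using (_⊎-dec_)
open import Relation.Binary.PropositionalEquality hiding ([_])

private variable
  m : ℕ

minList-≤ : ∀ {x xs} → x ∈ xs → minList xs ≤ x
minList-≤ {xs = _ ∷ []}     (here refl) = ≤-refl
minList-≤ {xs = x ∷ y ∷ ys} (here refl) = m⊓n≤m x _
minList-≤ {xs = x ∷ y ∷ ys} (there x∈) = ≤-trans (m⊓n≤n x _) (minList-≤ x∈)

≤-minList : ∀ {b x xs} → (∀ {y} → y ∈ xs → b ≤ y) → x ∈ xs → b ≤ minList xs
≤-minList {xs = _ ∷ []}     lb _ = lb (here refl)
≤-minList {xs = x ∷ y ∷ ys} lb _ = ⊓-glb (lb (here refl)) (≤-minList (lb ∘ there) (here refl))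

minList-map-≤ : ∀ {A : Set} (f : A → ℕ) {x xs} → x ∈ xs → minList (map f xs) ≤ f x
minList-map-≤ f x∈ = minList-≤ (∈-map⁺ f x∈)

≤-minList-map : ∀ {A : Set} (f : A → ℕ) {b x xs} → (∀ {y} → y ∈ xs → b ≤ f y) → x ∈ xs →
  b ≤ minList (map f xs)
≤-minList-map f lb x∈ = ≤-minList bound (∈-map⁺ f x∈)
  where
  bound : ∀ {z} → z ∈ map f _ → _ ≤ z
  bound z∈ with ∈-map⁻ f z∈
  ... | _ , y∈ , refl = lb y∈

∈⇒≤sum : ∀ {x xs} → x ∈ xs → x ≤ sum xs
∈⇒≤sum {xs = _ ∷ xs} (here refl) = m≤m+n _ (sum xs)
∈⇒≤sum {xs = y ∷ _}  (there x∈)  = ≤-trans (∈⇒≤sum x∈) (m≤n+m _ y)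

!≤sum : ∀ (v : Vec ℕ m) i → v ! i ≤ Vec.sum v
!≤sum []      i       = z≤n
!≤sum (x ∷ v) zero    = m≤m+n x (Vec.sum v)
!≤sum (x ∷ v) (suc i) = ≤-trans (!≤sum v i) (m≤n+m _ x)

All-! : ∀ {P : ℕ → Set} {v : Vec ℕ m} {i} → All P v → i < m → P (v ! i)
All-! {i = zero}  (p ∷ _)  _         = p
All-! {i = suc i} (_ ∷ ps) (s≤s i<m) = All-! ps i<m

reverse-∷ʳ : ∀ {A : Set} x (xs : Vec A m) → reverse (xs ∷ʳ x) ≡ x ∷ reverse xs
reverse-∷ʳ x []       = refl
reverse-∷ʳ x (y ∷ xs) = begin
  reverse (y ∷ (xs ∷ʳ x))    ≡⟨ Vecₚ.reverse-∷ y (xs ∷ʳ x) ⟩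
  reverse (xs ∷ʳ x) ∷ʳ y     ≡⟨ cong (_∷ʳ y) (reverse-∷ʳ x xs) ⟩
  x ∷ (reverse xs ∷ʳ y)      ≡⟨ cong (x ∷_) (Vecₚ.reverse-∷ y xs) ⟨
  x ∷ reverse (y ∷ xs)       ∎
  where open ≡-Reasoning

-- The enumeration 𝒮 of orderings

size-pos : ∀ t → 1 ≤ size t
size-pos leaf       = s≤s z≤n
size-pos (node l r) = ≤-trans (size-pos l) (m≤m+n (size l) (size r))

Enumerates : ℕ → List Tree → Set
Enumerates s ts = ∀ t → t ∈ ts ⇔ size t ≡ s

AscendingSizes : ℕ → Vec (List Tree) m → Set
AscendingSizes s []         = ⊤
AscendingSizes s (ts ∷ tss) = Enumerates s ts × AscendingSizes (suc s) tss

DescendingSizes : Vec (List Tree) m → Set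
DescendingSizes []                = ⊤
DescendingSizes (_∷_ {m} ts tss)  = Enumerates (suc m) ts × DescendingSizes tss

AscendingSizes-∷ʳ : ∀ {s ts} (tss : Vec (List Tree) m) →
  AscendingSizes s tss → Enumerates (s + m) ts → AscendingSizes s (tss ∷ʳ ts)
AscendingSizes-∷ʳ {s = s} {ts} [] _ e = subst (λ x → Enumerates x ts) (+-identityʳ s) e , tt
AscendingSizes-∷ʳ {suc m} {s} {ts} (_ ∷ tss) (e₀ , asc) e =
  e₀ , AscendingSizes-∷ʳ tss asc (subst (λ x → Enumerates x ts) (+-suc s m) e)

-- When v lists the trees of sizes s, s + 1, … and w those of sizes m, m − 1, …, entry i of
-- the zip pairs sizes s + i and m − i: products v w holds the nodes of size s + m whose
-- left subtree has size in [s, s + m).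
products : Vec (List Tree) m → Vec (List Tree) m → List Tree
products v w = concat (toList (zipWith (cartesianProductWith node) v w))

∈-products⁻ : ∀ {s t} {v w : Vec (List Tree) m} → AscendingSizes s v → DescendingSizes w →
  t ∈ products v w → size t ≡ s + m
∈-products⁻ {v = []} {[]} _ _ ()
∈-products⁻ {v = x ∷ v} {y ∷ w} (ex , asc) (ey , desc) t∈
  with ∈-++⁻ (cartesianProductWith node x y) t∈
... | inj₁ t∈xy with ∈-cartesianProductWith⁻ node x y t∈xy
...   | l , r , l∈ , r∈ , refl = cong₂ _+_ (Equivalence.to (ex l) l∈) (Equivalence.to (ey r) r∈)
∈-products⁻ {m = suc m} {s = s} (ex , asc) (ey , desc) t∈ | inj₂ t∈vw =
  trans (∈-products⁻ asc desc t∈vw) (sym (+-suc s m))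

∈-products⁺ : ∀ {s l r} {v w : Vec (List Tree) m} → AscendingSizes s v → DescendingSizes w →
  s ≤ size l → size l < s + m → size l + size r ≡ s + m → node l r ∈ products v w
∈-products⁺ {zero} {s = s} _ _ s≤l l<s+0 _ =
  ⊥-elim (<⇒≱ l<s+0 (subst (_≤ _) (sym (+-identityʳ s)) s≤l))
∈-products⁺ {m = suc m} {s = s} {l} {r} {x ∷ v} {y ∷ w} (ex , asc) (ey , desc) s≤l l< sum
  with m≤n⇒m<n∨m≡n s≤l
... | inj₂ refl = ∈-++⁺ˡ (∈-cartesianProductWith⁺ node (Equivalence.from (ex l) refl)
                          (Equivalence.from (ey r) (+-cancelˡ-≡ s _ _ sum)))
... | inj₁ s<l = ∈-++⁺ʳ (cartesianProductWith node x y)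
    (∈-products⁺ asc desc s<l (subst (size l <_) (+-suc s m) l<) (trans sum (+-suc s m)))

-- Defs keeps table and next private: these metavariables are solved by unification with
-- the defining clause of 𝒮, so that table m and tableNext m are Defs' table m and next (table m).
mutual
  table : (m : ℕ) → Vec (List Tree) m
  table = _

  tableNext : ℕ → List Tree
  tableNext = _

  𝒮-unfold : ∀ m → 𝒮 (suc m) ≡ Vec.last (table m ∷ʳ tableNext m)
  𝒮-unfold m = refl

tableNext-suc : ∀ m → tableNext (suc m) ≡ products (table (suc m)) (reverse (table (suc m)))
tableNext-suc m with table (suc m)
... | _ ∷ _ = refl

TableSizes : (m : ℕ) → Set
TableSizes m = AscendingSizes 1 (table m) × DescendingSizes (reverse (table m))

tableNext-enumerates : ∀ m → TableSizes m → Enumerates (suc m) (tableNext m)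
tableNext-enumerates zero _ t = mk⇔ to (from t)
  where
  to : t ∈ leaf ∷ [] → size t ≡ 1
  to (here refl) = refl
  from : ∀ t → size t ≡ 1 → t ∈ leaf ∷ []
  from leaf       _  = here refl
  from (node l r) eq = ⊥-elim (<⇒≢ (+-mono-≤ (size-pos l) (size-pos r)) (sym eq))
tableNext-enumerates (suc m) (asc , desc) t rewrite tableNext-suc m =
  mk⇔ (∈-products⁻ asc desc) (from t)
  where
  from : ∀ t → size t ≡ suc (suc m) → t ∈ products (table (suc m)) (reverse (table (suc m)))
  from leaf ()
  from (node l r) eq =
    ∈-products⁺ asc desc (size-pos l) (subst (size l <_) eq (m<m+n (size l) (size-pos r))) eq

table-sizes : ∀ m → TableSizes m
table-sizes zero    = tt , tt
table-sizes (suc m) with table-sizes m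
... | sizes@(asc , desc) =
  AscendingSizes-∷ʳ (table m) asc (tableNext-enumerates m sizes) ,
  subst DescendingSizes (sym (reverse-∷ʳ (tableNext m) (table m)))
        (tableNext-enumerates m sizes , desc)

𝒮-enumerates : ∀ m → Enumerates (suc m) (𝒮 (suc m))
𝒮-enumerates m = subst (Enumerates (suc m))
  (sym (trans (𝒮-unfold m) (Vecₚ.last-∷ʳ (tableNext m) (table m))))
  (tableNext-enumerates m (table-sizes m))

-- Orderings that fan out from a dimension

size-leftComb : ∀ m → size (leftComb m) ≡ suc m
size-leftComb zero    = refl
size-leftComb (suc m) = trans (cong (_+ 1) (size-leftComb m)) (cong suc (+-comm m 1))

size-rightComb : ∀ m → size (rightComb m) ≡ suc m
size-rightComb zero    = refl
size-rightComb (suc m) = cong suc (size-rightComb m)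

fan : ℕ → ℕ → Tree
fan zero    zero    = leaf
fan zero    (suc q) = leftComb q
fan (suc p) zero    = rightComb p
fan (suc p) (suc q) = node (rightComb p) (leftComb q)

ℰ-suc : ∀ n h → ℰ n (suc h) ≡ fan (suc h) (n ∸ suc h)
ℰ-suc n h with n ∸ suc h
... | zero  = refl
... | suc _ = refl

ℰ≡fan : ∀ p q → ℰ (p + q) p ≡ fan p q
ℰ≡fan zero    zero    = refl
ℰ≡fan zero    (suc q) = refl
ℰ≡fan (suc p) q       = trans (ℰ-suc (suc p + q) p) (cong (fan (suc p)) (m+n∸m≡n p q))

size-fan : ∀ p q → 1 ≤ p + q → size (fan p q) ≡ p + q
size-fan zero    zero    ()
size-fan zero    (suc q) _ = size-leftComb q
size-fan (suc p) zero    _ = trans (size-rightComb p) (cong suc (sym (+-identityʳ p)))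
size-fan (suc p) (suc q) _ = cong₂ _+_ (size-rightComb p) (size-leftComb q)

-- FansFrom h a t: t, as an ordering of M_{a+1} ⋯ M_{a + size t}, has k_h in the cost term
-- of every multiplication.
data FansFrom (h : ℕ) : ℕ → Tree → Set where
  leaf : ∀ {a} → FansFrom h a leaf
  node : ∀ {a l r} → h ≡ a ⊎ h ≡ a + size l ⊎ h ≡ a + size l + size r →
         FansFrom h a l → FansFrom h (a + size l) r → FansFrom h a (node l r)

leftComb-fans : ∀ {a} m → FansFrom a a (leftComb m)
leftComb-fans zero    = leaf
leftComb-fans (suc m) = node (inj₁ refl) (leftComb-fans m) leaf

rightComb-fans : ∀ {h a} m → h ≡ a + suc m → FansFrom h a (rightComb m)
rightComb-fans zero    _  = leaf
rightComb-fans {a = a} (suc m) eq =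
  node (inj₂ (inj₂ (trans eq (sym (trans (cong (λ x → a + 1 + x) (size-rightComb m))
                                          (+-assoc a 1 (suc m)))))))
       leaf (rightComb-fans m (trans eq (sym (+-assoc a 1 (suc m)))))

fan-fans : ∀ {a} p q → FansFrom (a + p) a (fan p q)
fan-fans {a} zero    zero    = leaf
fan-fans {a} zero    (suc q) =
  subst (λ h → FansFrom h a (leftComb q)) (sym (+-identityʳ a)) (leftComb-fans q)
fan-fans     (suc p) zero    = rightComb-fans p refl
fan-fans {a} (suc p) (suc q) =
  node (inj₂ (inj₁ (cong (a +_) (sym (size-rightComb p))))) (rightComb-fans p refl)
       (subst (λ h → FansFrom h (a + size (rightComb p)) (leftComb q))
              (cong (a +_) (size-rightComb p)) (leftComb-fans q))

split-bounds : ∀ {h a l r} → h ≡ a ⊎ h ≡ a + size l ⊎ h ≡ a + size l + size r →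
  a ≤ h × h ≤ a + (size l + size r)
split-bounds {a = a} {l} {r} (inj₁ refl) = ≤-refl , m≤m+n a _
split-bounds {a = a} {l} {r} (inj₂ (inj₁ refl)) = m≤m+n a _ , +-monoʳ-≤ a (m≤m+n (size l) (size r))
split-bounds {a = a} {l} {r} (inj₂ (inj₂ refl)) =
  ≤-trans (m≤m+n a (size l)) (m≤m+n _ (size r)) , ≤-reflexive (+-assoc a (size l) (size r))

fans-below : ∀ {h a t} → FansFrom h a t → h < a → t ≡ leaf
fans-below leaf _ = refl
fans-below (node {l = l} {r} split _ _) h<a =
  ⊥-elim (<⇒≱ h<a (proj₁ (split-bounds {l = l} {r} split)))

fans-above : ∀ {h a t} → FansFrom h a t → a + size t < h → t ≡ leaf
fans-above leaf _ = refl
fans-above (node {l = l} {r} split _ _) h>t =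
  ⊥-elim (<⇒≱ h>t (proj₂ (split-bounds {l = l} {r} split)))

fan-unit : ∀ p q → p + q ≡ 1 → fan p q ≡ leaf
fan-unit zero          (suc zero)    _ = refl
fan-unit (suc zero)    zero          _ = refl
fan-unit zero          zero          ()
fan-unit zero          (suc (suc _)) ()
fan-unit (suc zero)    (suc _)       ()
fan-unit (suc (suc _)) _             ()

fan-snoc : ∀ {s} → 1 ≤ s → node (fan 0 s) leaf ≡ fan 0 (s + 1)
fan-snoc {suc s} _ = cong leftComb (+-comm 1 s)

fan-join : ∀ {p q} → 1 ≤ p → 1 ≤ q → node (fan p 0) (fan 0 q) ≡ fan p q
fan-join {suc p} {suc q} _ _ = refl

fan-cons : ∀ {s} → 1 ≤ s → node leaf (fan s 0) ≡ fan (suc s) 0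
fan-cons {suc s} _ = refl

fans⇒fan : ∀ {h a p q t} → FansFrom h a t → h ≡ a + p → size t ≡ p + q → t ≡ fan p q
fans⇒fan {p = p} {q} leaf _ eq = sym (fan-unit p q (sym eq))
fans⇒fan {a = a} {p} (node {l = l} {r} split fl fr) refl eq with split
... | inj₁ e with +-cancelˡ-≡ a p 0 (trans e (sym (+-identityʳ a)))
...   | refl with fans-below fr (+-monoʳ-< a (size-pos l))
...     | refl rewrite sym eq =
  trans (cong (λ x → node x leaf) (fans⇒fan fl refl refl)) (fan-snoc (size-pos l))
fans⇒fan {a = a} {p} (node {l = l} {r} split fl fr) refl eq | inj₂ (inj₁ e)
  with +-cancelˡ-≡ a p (size l) e
... | refl with +-cancelˡ-≡ (size l) _ _ eq
...   | refl = trans (cong₂ node (fans⇒fan fl refl (sym (+-identityʳ _)))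
                                 (fans⇒fan fr (sym (+-identityʳ _)) refl))
                     (fan-join (size-pos l) (size-pos r))
fans⇒fan {a = a} {p} {q} (node {l = l} {r} split fl fr) refl eq | inj₂ (inj₂ e)
  with +-cancelˡ-≡ a p _ (trans e (+-assoc a (size l) (size r)))
... | refl with fans-above fl (+-monoʳ-< a (m<m+n (size l) (size-pos r)))
...   | refl with +-cancelˡ-≡ (suc (size r)) q 0 (trans (sym eq) (sym (+-identityʳ _)))
...     | refl =
  trans (cong (node leaf) (fans⇒fan fr (sym (+-assoc a 1 (size r))) (sym (+-identityʳ _))))
        (fan-cons (size-pos r))

ℰ≡fan-∸ : ∀ {h n} → h ≤ n → ℰ n h ≡ fan h (n ∸ h)
ℰ≡fan-∸ {h} {n} h≤n = trans (cong (λ x → ℰ x h) (sym (m+[n∸m]≡n h≤n))) (ℰ≡fan h (n ∸ h))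

ℰ-fans : ∀ {h n} → h ≤ n → FansFrom h 0 (ℰ n h)
ℰ-fans {h} {n} h≤n = subst (FansFrom h 0) (sym (ℰ≡fan-∸ h≤n)) (fan-fans h (n ∸ h))

size-ℰ : ∀ {h m} → h ≤ suc m → size (ℰ (suc m) h) ≡ suc m
size-ℰ {h} {m} h≤n = trans (cong size (ℰ≡fan-∸ h≤n))
  (trans (size-fan h (suc m ∸ h) (≤-trans (s≤s z≤n) (≤-reflexive (sym eq)))) eq)
  where
  eq = m+[n∸m]≡n h≤n

ℰ-unique : ∀ {h n t} → h ≤ n → FansFrom h 0 t → size t ≡ n → t ≡ ℰ n h
ℰ-unique h≤n fans size≡n =
  trans (fans⇒fan fans refl (trans size≡n (sym (m+[n∸m]≡n h≤n)))) (sym (ℰ≡fan-∸ h≤n))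

ℰ∈𝒮 : ∀ {h m} → h ≤ suc m → ℰ (suc m) h ∈ 𝒮 (suc m)
ℰ∈𝒮 {m = m} h≤n = Equivalence.from (𝒮-enumerates m _) (size-ℰ h≤n)

cost-left-≤ : ∀ (k : Vec ℕ m) a l r → cost k a l ≤ cost k a (node l r)
cost-left-≤ k a l r = ≤-trans (m≤m+n _ _) (m≤m+n _ _)

cost-right-≤ : ∀ (k : Vec ℕ m) a l r → cost k (a + size l) r ≤ cost k a (node l r)
cost-right-≤ k a l r = ≤-trans (m≤n+m _ (cost k a l)) (m≤m+n _ _)

cost-root-≤ : ∀ (k : Vec ℕ m) a l r →
  k ! a * k ! (a + size l) * k ! (a + size l + size r) ≤ cost k a (node l r)
cost-root-≤ k a l r = m≤n+m _ _

node-indices-≤ : ∀ {n} a l r → a + (size l + size r) ≤ n →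
  a ≤ n × a + size l ≤ n × a + size l + size r ≤ n
node-indices-≤ a l r bd =
  ≤-trans (m≤m+n a _) bd ,
  ≤-trans (+-monoʳ-≤ a (m≤m+n (size l) (size r))) bd ,
  ≤-trans (≤-reflexive (+-assoc a (size l) (size r))) bd

product-with-unit-≤ : ∀ {x y z N} → x ≡ 1 ⊎ y ≡ 1 ⊎ z ≡ 1 → x ≤ N → y ≤ N → z ≤ N →
  x * y * z ≤ N * N
product-with-unit-≤ {y = y} {z} (inj₁ refl) _ y≤ z≤ =
  ≤-trans (≤-reflexive (cong (_* z) (*-identityˡ y))) (*-mono-≤ y≤ z≤)
product-with-unit-≤ {x} {z = z} (inj₂ (inj₁ refl)) x≤ _ z≤ =
  ≤-trans (≤-reflexive (cong (_* z) (*-identityʳ x))) (*-mono-≤ x≤ z≤)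
product-with-unit-≤ {x} {y} (inj₂ (inj₂ refl)) x≤ y≤ _ =
  ≤-trans (≤-reflexive (*-identityʳ (x * y))) (*-mono-≤ x≤ y≤)

fans-cost-≤ : ∀ {k : Vec ℕ m} {h N a t} → k ! h ≡ 1 → (∀ i → k ! i ≤ N) →
  FansFrom h a t → cost k a t + N * N ≤ size t * (N * N)
fans-cost-≤ {N = N} _ _ leaf = ≤-reflexive (sym (*-identityˡ (N * N)))
fans-cost-≤ {k = k} {h} {N} {a} kₕ≡1 k≤N (node {l = l} {r} split fl fr) = begin
  cₗ + cᵣ + root + N * N     ≤⟨ +-monoˡ-≤ (N * N) (+-monoʳ-≤ (cₗ + cᵣ) root≤) ⟩
  cₗ + cᵣ + N * N + N * N    ≡⟨ trans (+-assoc (cₗ + cᵣ) (N * N) (N * N))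
                                       (+-interchange cₗ cᵣ (N * N) (N * N)) ⟩
  (cₗ + N * N) + (cᵣ + N * N) ≤⟨ +-mono-≤ (fans-cost-≤ kₕ≡1 k≤N fl) (fans-cost-≤ kₕ≡1 k≤N fr) ⟩
  size l * (N * N) + size r * (N * N) ≡⟨ *-distribʳ-+ (N * N) (size l) (size r) ⟨
  (size l + size r) * (N * N) ∎
  where
  open ≤-Reasoning
  cₗ cᵣ root : ℕ
  cₗ = cost k a l
  cᵣ = cost k (a + size l) r
  root = k ! a * k ! (a + size l) * k ! (a + size l + size r)
  unit : ∀ {i} → h ≡ i → k ! i ≡ 1
  unit refl = kₕ≡1
  root≤ : root ≤ N * N
  root≤ = product-with-unit-≤ (Sum.map unit (Sum.map unit unit) split) (k≤N _) (k≤N _) (k≤N _)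

nonfan-cost-≥ : ∀ {k : Vec ℕ m} {n h N} → (∀ i → i ≤ n → i ≢ h → N ≤ k ! i) →
  ∀ a t → a + size t ≤ n → FansFrom h a t ⊎ N * N * N ≤ cost k a t
nonfan-cost-≥ big a leaf _ = inj₁ leaf
nonfan-cost-≥ {k = k} {h = h} big a (node l r) bd
  with node-indices-≤ a l r bd
... | a≤n , b≤n , c≤n
  with nonfan-cost-≥ big a l b≤n | nonfan-cost-≥ big (a + size l) r c≤n
... | inj₂ costly | _           = inj₂ (≤-trans costly (cost-left-≤ k a l r))
... | inj₁ _      | inj₂ costly = inj₂ (≤-trans costly (cost-right-≤ k a l r))
... | inj₁ fl     | inj₁ fr
  with h ≟ a ⊎-dec h ≟ a + size l ⊎-dec h ≟ a + size l + size r
...   | yes split = inj₁ (node split fl fr)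
...   | no ¬split = inj₂ (≤-trans
          (*-mono-≤ (*-mono-≤ (big a a≤n (¬split ∘ inj₁ ∘ sym))
                              (big _ b≤n (¬split ∘ inj₂ ∘ inj₁ ∘ sym)))
                    (big _ c≤n (¬split ∘ inj₂ ∘ inj₂ ∘ sym)))
          (cost-root-≤ k a l r))

cost-pos : ∀ {n} {k : Vec ℕ (suc n)} {t} → All (1 ≤_) k → 2 ≤ size t → size t ≤ n → 1 ≤ T t k
cost-pos {t = leaf}     _   (s≤s ()) _
cost-pos {k = k} {node l r} pos _ bd with node-indices-≤ 0 l r bd
... | a≤n , b≤n , c≤n =
  ≤-trans (*-mono-≤ (*-mono-≤ (All-! pos (s≤s a≤n)) (All-! pos (s≤s b≤n))) (All-! pos (s≤s c≤n)))
          (cost-root-≤ k 0 l r)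

-- The instance with k_h = 1 and all other dimensions N

dims : (ℕ → ℕ) → (m : ℕ) → Vec ℕ m
dims f zero    = []
dims f (suc m) = f 0 ∷ dims (f ∘ suc) m

!-dims : ∀ f {m i} → i < m → dims f m ! i ≡ f i
!-dims f {suc m} {zero}  _         = refl
!-dims f {suc m} {suc i} (s≤s i<m) = !-dims (f ∘ suc) i<m

!-dims-≤ : ∀ {f b} → (∀ i → f i ≤ b) → ∀ m i → dims f m ! i ≤ b
!-dims-≤ f≤ zero    _       = z≤n
!-dims-≤ f≤ (suc m) zero    = f≤ 0
!-dims-≤ f≤ (suc m) (suc i) = !-dims-≤ (f≤ ∘ suc) m i

All-dims : ∀ {P : ℕ → Set} {f} → (∀ i → P (f i)) → ∀ m → All P (dims f m)
All-dims p zero    = []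
All-dims p (suc m) = p 0 ∷ All-dims (p ∘ suc) m

spikeAt : ℕ → ℕ → ℕ → ℕ
spikeAt N h i with i ≟ h
... | yes _ = 1
... | no  _ = N

spikeAt-≡ : ∀ N h → spikeAt N h h ≡ 1
spikeAt-≡ N h with h ≟ h
... | yes _   = refl
... | no  h≢h = ⊥-elim (h≢h refl)

spikeAt-≢ : ∀ {N h i} → i ≢ h → spikeAt N h i ≡ N
spikeAt-≢ {h = h} {i} i≢h with i ≟ h
... | yes i≡h = ⊥-elim (i≢h i≡h)
... | no  _   = refl

spikeAt-range : ∀ {N} h i → 1 ≤ N → 1 ≤ spikeAt N h i × spikeAt N h i ≤ N
spikeAt-range h i 1≤N with i ≟ h
... | yes _ = ≤-refl , 1≤N
... | no  _ = 1≤N , ≤-refl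

spike : ℕ → ℕ → (n : ℕ) → Vec ℕ (suc n)
spike N h n = dims (spikeAt N h) (suc n)

spike-≡ : ∀ {N h n} → h ≤ n → spike N h n ! h ≡ 1
spike-≡ {N} {h} h≤n = trans (!-dims (spikeAt N h) (s≤s h≤n)) (spikeAt-≡ N h)

spike-≢ : ∀ {N h n} i → i ≤ n → i ≢ h → spike N h n ! i ≡ N
spike-≢ {N} {h} i i≤n i≢h = trans (!-dims (spikeAt N h) (s≤s i≤n)) (spikeAt-≢ i≢h)

spike-≤ : ∀ {N h n} → 1 ≤ N → ∀ i → spike N h n ! i ≤ N
spike-≤ {h = h} {n} 1≤N = !-dims-≤ (λ i → proj₂ (spikeAt-range h i 1≤N)) (suc n)

spike-positive : ∀ {N h n} → 1 ≤ N → All (1 ≤_) (spike N h n)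
spike-positive {h = h} {n} 1≤N = All-dims (λ i → proj₁ (spikeAt-range h i 1≤N)) (suc n)

-- r + 1 < ratBound r, since r ≤ ∣↥ r∣.
ratBound : ℚ → ℕ
ratBound r = 2 + ℤ.∣ ℚ.↥ r ∣

<-/-1 : ∀ r W d → ratBound r * suc d ≤ W → r ℚ.< (ℤ.+ W / suc d) - 1ℚ
<-/-1 r@(mkℚ p q _) W d hyp =
  toℚᵘ-cancel-< (<-respʳ-≃ (≃-sym rhs≃) (*<* (subst₂ ℤ._<_ lhs≡ rhs≡ (gapℤ p hyp))))
  where
  sd≤W : suc d ≤ W
  sd≤W = ≤-trans (m≤m+n (suc d) _) hyp
  gapℕ : ∀ a → (2 + a) * suc d ≤ W → a * suc d < (W ∸ suc d) * suc q
  gapℕ a ≤W = begin-strict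
    a * suc d               <⟨ m<n+m (a * suc d) z<s ⟩
    suc a * suc d           ≡⟨ m+n∸m≡n (suc d) (suc a * suc d) ⟨
    (2 + a) * suc d ∸ suc d ≤⟨ ∸-monoˡ-≤ (suc d) ≤W ⟩
    W ∸ suc d               ≤⟨ m≤m*n (W ∸ suc d) (suc q) ⟩
    (W ∸ suc d) * suc q     ∎
    where open ≤-Reasoning
  gapℤ : ∀ p → (2 + ℤ.∣ p ∣) * suc d ≤ W → p ℤ.* ℤ.+ suc d ℤ.< ℤ.+ ((W ∸ suc d) * suc q)
  gapℤ (ℤ.+ a)  ≤W = subst (ℤ._< _) (ℤ.pos-* a (suc d)) (+<+ (gapℕ a ≤W))
  gapℤ -[1+ a ] _   = -<+
  rhs≃ : toℚᵘ ((ℤ.+ W / suc d) - 1ℚ) ℚᵘ.≃ mkℚᵘ (ℤ.+ W) d ℚᵘ.+ mkℚᵘ -[1+ 0 ] 0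
  rhs≃ = ≃-trans (toℚᵘ-homo-+ (ℤ.+ W / suc d) (ℚ.- 1ℚ))
                 (+-congˡ (mkℚᵘ -[1+ 0 ] 0) (toℚᵘ-fromℚᵘ (mkℚᵘ (ℤ.+ W) d)))
  lhs≡ : p ℤ.* ℤ.+ suc d ≡ p ℤ.* ℤ.+ suc (d * 1)
  lhs≡ = cong (λ x → p ℤ.* ℤ.+ suc x) (sym (*-identityʳ d))
  W-sd≡ : ℤ.+ W ℤ.* ℤ.+ 1 ℤ.+ -[1+ 0 ] ℤ.* ℤ.+ suc d ≡ W ℤ.⊖ suc d
  W-sd≡ = cong₂ ℤ._+_ (ℤ.*-identityʳ (ℤ.+ W)) (ℤ.-1*i≡-i (ℤ.+ suc d))
  rhs≡ : ℤ.+ ((W ∸ suc d) * suc q) ≡ (ℤ.+ W ℤ.* ℤ.+ 1 ℤ.+ -[1+ 0 ] ℤ.* ℤ.+ suc d) ℤ.* ℤ.+ suc q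
  rhs≡ = begin
    ℤ.+ ((W ∸ suc d) * suc q)                              ≡⟨ ℤ.pos-* (W ∸ suc d) (suc q) ⟩
    ℤ.+ (W ∸ suc d) ℤ.* ℤ.+ suc q                          ≡⟨ cong (ℤ._* ℤ.+ suc q) (ℤ.⊖-≥ sd≤W) ⟨
    (W ℤ.⊖ suc d) ℤ.* ℤ.+ suc q                            ≡⟨ cong (ℤ._* ℤ.+ suc q) W-sd≡ ⟨
    (ℤ.+ W ℤ.* ℤ.+ 1 ℤ.+ -[1+ 0 ] ℤ.* ℤ.+ suc d) ℤ.* ℤ.+ suc q ∎
    where open ≡-Reasoning

r<P : ∀ {n Q k} r → 0 < minCost n k → ratBound r * minCost n k ≤ minCostWithout n Q k →
  r ℚ.< P n Q k
r<P {n} {Q} {k} r 0<min gap with minCost n k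
... | zero  = ⊥-elim (<-irrefl refl 0<min)
... | suc d = <-/-1 r (minCostWithout n Q k) d gap

==-refl : ∀ t → (t == t) ≡ true
==-refl leaf       = refl
==-refl (node l r) rewrite ==-refl l | ==-refl r = refl

∈ᵇ-self : ∀ t → ¬ Bool.T (not (t ∈ᵇ [ t ]))
∈ᵇ-self t rewrite ==-refl t = λ ()

another-ordering : ∀ m t → ∃ λ u → size u ≡ 3 + m × Bool.T (not (u ∈ᵇ [ t ]))
another-ordering m leaf                = leftComb (2 + m) , size-leftComb (2 + m) , tt
another-ordering m (node leaf _)       = leftComb (2 + m) , size-leftComb (2 + m) , tt
another-ordering m (node (node _ _) _) = rightComb (2 + m) , size-rightComb (2 + m) , tt

minCost-spike-≤ : ∀ {N h m} → 1 ≤ N → h ≤ suc m →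
  minCost (suc m) (spike N h (suc m)) ≤ suc m * (N * N)
minCost-spike-≤ {N} {h} {m} 1≤N h≤n = begin
  minCost (suc m) k       ≤⟨ minList-map-≤ (λ A → T A k) (ℰ∈𝒮 h≤n) ⟩
  T E k                   ≤⟨ m≤m+n (T E k) (N * N) ⟩
  T E k + N * N           ≤⟨ fans-cost-≤ (spike-≡ h≤n) (spike-≤ 1≤N) (ℰ-fans h≤n) ⟩
  size E * (N * N)        ≡⟨ cong (_* (N * N)) (size-ℰ h≤n) ⟩
  suc m * (N * N)         ∎
  where
  open ≤-Reasoning
  k : Vec ℕ (suc (suc m))
  k = spike N h (suc m)
  E : Tree
  E = ℰ (suc m) h

minCost-spike-pos : ∀ {N h m} → 1 ≤ N → h ≤ suc (suc m) →
  0 < minCost (suc (suc m)) (spike N h (suc (suc m)))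
minCost-spike-pos {N} {h} {m} 1≤N h≤n =
  ≤-minList-map (λ A → T A (spike N h n)) positive (ℰ∈𝒮 h≤n)
  where
  n : ℕ
  n = suc (suc m)
  positive : ∀ {A} → A ∈ 𝒮 n → 1 ≤ T A (spike N h n)
  positive {A} A∈ with Equivalence.to (𝒮-enumerates (suc m) A) A∈
  ... | size≡n = cost-pos {t = A} (spike-positive {N} {h} 1≤N)
                          (subst (2 ≤_) (sym size≡n) (s≤s (s≤s z≤n))) (≤-reflexive size≡n)

minCostWithout-spike-≥ : ∀ {N h m} → h ≤ 3 + m →
  N * N * N ≤ minCostWithout (3 + m) [ ℰ (3 + m) h ] (spike N h (3 + m))
minCostWithout-spike-≥ {N} {h} {m} h≤n with another-ordering m (ℰ (3 + m) h)
... | u , size-u , u-kept =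
  ≤-minList-map (λ B → T B k) costly
    (∈-filter⁺ (Bool.T? ∘ kept) (Equivalence.from (𝒮-enumerates (2 + m) u) size-u) u-kept)
  where
  n : ℕ
  n = 3 + m
  k : Vec ℕ (suc n)
  k = spike N h n
  kept : Tree → Bool
  kept B = not (B ∈ᵇ [ ℰ n h ])
  big : ∀ i → i ≤ n → i ≢ h → N ≤ k ! i
  big i i≤n i≢h = ≤-reflexive (sym (spike-≢ i i≤n i≢h))
  costly : ∀ {B} → B ∈ filterᵇ kept (𝒮 n) → N * N * N ≤ T B k
  costly {B} B∈ with ∈-filter⁻ (Bool.T? ∘ kept) B∈
  ... | B∈𝒮 , B-kept with Equivalence.to (𝒮-enumerates (2 + m) B) B∈𝒮
  ...   | size≡n with nonfan-cost-≥ big 0 B (≤-reflexive size≡n)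
  ...     | inj₂ expensive = expensive
  ...     | inj₁ fans      =
    ⊥-elim (∈ᵇ-self (ℰ n h) (subst (Bool.T ∘ kept) (ℰ-unique h≤n fans size≡n) B-kept))

spike-gap : ∀ {c N h m} → 1 ≤ N → c * (3 + m) ≤ N → h ≤ 3 + m →
  c * minCost (3 + m) (spike N h (3 + m)) ≤
  minCostWithout (3 + m) [ ℰ (3 + m) h ] (spike N h (3 + m))
spike-gap {c} {N} {h} {m} 1≤N cn≤N h≤n = begin
  c * minCost n (spike N h n) ≤⟨ *-monoʳ-≤ c (minCost-spike-≤ 1≤N h≤n) ⟩
  c * (n * (N * N))           ≡⟨ *-assoc c n (N * N) ⟨
  c * n * (N * N)             ≤⟨ *-monoˡ-≤ (N * N) cn≤N ⟩
  N * (N * N)                 ≡⟨ *-assoc N N N ⟨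
  N * N * N                   ≤⟨ minCostWithout-spike-≥ h≤n ⟩
  minCostWithout n [ ℰ n h ] (spike N h n) ∎
  where
  open ≤-Reasoning
  n : ℕ
  n = 3 + m

entryBound : List (Vec ℕ m) → ℕ
entryBound L = sum (map Vec.sum L)

index-≢ : ∀ {n} → 1 ≤ n → ∀ h → ∃ λ i → i ≤ n × i ≢ h
index-≢ 1≤n zero    = 1 , 1≤n , λ ()
index-≢ 1≤n (suc h) = 0 , z≤n , λ ()

spike-∉ : ∀ {N h n} {L : List (Vec ℕ (suc n))} → 1 ≤ n → entryBound L < N → spike N h n ∉ L
spike-∉ {N} {h} {n} {L} 1≤n N>L k∈L with index-≢ 1≤n h
... | i , i≤n , i≢h = <⇒≱ N>L (begin
  N                        ≡⟨ spike-≢ i i≤n i≢h ⟨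
  spike N h n ! i          ≤⟨ !≤sum (spike N h n) i ⟩
  Vec.sum (spike N h n)    ≤⟨ ∈⇒≤sum (∈-map⁺ Vec.sum k∈L) ⟩
  entryBound L             ∎)
  where open ≤-Reasoning

lemma5p1 : (n : ℕ) → 3 ≤ n → (r : ℚ) → 0ℚ ℚ.< r → (h : ℕ) → h ≤ n →
    (L : List (Vec ℕ (suc n))) →
      Σ (Vec ℕ (suc n)) (λ k → k ∉ L × All (λ x → 1 ≤ x) k × r ℚ.< P n [ ℰ n h ] k)
lemma5p1 zero ()
lemma5p1 (suc zero) (s≤s ())
lemma5p1 (suc (suc zero)) (s≤s (s≤s ()))
lemma5p1 n@(suc (suc (suc _))) _ r _ h h≤n L =
  spike N h n , spike-∉ (s≤s z≤n) N>L , spike-positive 1≤N ,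
  r<P {n} {[ ℰ n h ]} r (minCost-spike-pos 1≤N h≤n) (spike-gap {ratBound r} 1≤N cn≤N h≤n)
  where
  N : ℕ
  N = ratBound r * n + suc (entryBound L)
  N>L : entryBound L < N
  N>L = m≤n+m (suc (entryBound L)) (ratBound r * n)
  cn≤N : ratBound r * n ≤ N
  cn≤N = m≤m+n (ratBound r * n) (suc (entryBound L))
  1≤N : 1 ≤ N
  1≤N = ≤-trans (s≤s z≤n) N>L
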